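{- For a Dyck path $d$ of semilength $n$, we have $M_d=\{\delta_n\}$ if and only if $d$ equals its own bounce path, where $\delta_n=n(n-1)\cdots 1$.
   Context: A Dyck path of semilength $n$ is a lattice path from $(0,0)$ to $(2n,0)$ with steps $U=(1,1)$ and $D=(1,-1)$ never going below the $x$-axis. The bounce path of $d$: start at $(0,0)$, take up-steps until reaching a point of $d$ where $d$'s next step is a down-step, then take down-steps to the $x$-axis, then up-steps until again meeting a down-step of $d$, and so on until $(2n,0)$. For $\sigma=\sigma_1\cdots\sigma_n\in\mathfrak{S}_n$, $\mathrm{can}(d,\sigma)$ is the word of length $2n$ obtained by labeling the $i$-th up-step and the $i$-th down-step of $d$ with $\sigma_i$ and reading left to right; $\mathrm{des}(d,\sigma)$ is the number of $j\in[2n-1]$ with $\mathrm{can}(d,\sigma)_j>\mathrm{can}(d,\sigma)_{j+1}$. $m_d=\max_{\sigma\in\mathfrak{S}_n}\mathrm{des}(d,\sigma)$ and $M_d=\{\sigma\in\mathfrak{S}_n \mid \mathrm{des}(d,\sigma)=m_d\}$. -}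

module Defs where

open import Data.Nat using (ℕ; zero; suc; _*_; _∸_; _<ᵇ_; _≤_)
open import Data.Bool using (Bool; true; false; if_then_else_)
open import Data.List using (List; []; _∷_; length; replicate; _++_; map)
open import Data.Fin using (Fin; toℕ; opposite)
open import Data.Fin.Permutation using (Permutation′; _⟨$⟩ʳ_)
open import Data.Product using (_×_)
open import Relation.Binary.PropositionalEquality using (_≡_)

data Step : Set where
  U D : Step

-- ValidFrom h s : the path s, started at height h, never goes below the
-- x-axis and ends at height 0.
data ValidFrom : ℕ → List Step → Set where
  end  : ValidFrom 0 []
  up   : ∀ {h s} → ValidFrom (suc h) s → ValidFrom h (U ∷ s)
  down : ∀ {h s} → ValidFrom h s → ValidFrom (suc h) (D ∷ s)

IsDyck : ℕ → List Step → Set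
IsDyck n d = (length d ≡ 2 * n) × ValidFrom 0 d

-- Bounce path.
-- upsBefore k d = number of up-steps of d preceding its (k+1)-th down-step
-- (all up-steps of d if d has at most k down-steps).
upsBefore : ℕ → List Step → ℕ
upsBefore k       []      = 0
upsBefore k       (U ∷ s) = suc (upsBefore k s)
upsBefore zero    (D ∷ s) = 0
upsBefore (suc k) (D ∷ s) = upsBefore k s

-- Starting on the x-axis after c up- and c down-steps of the bounce path,
-- the bounce path goes up until it meets the point of d followed by d's
-- (c+1)-th down-step (i.e. until it has upsBefore c d up-steps), then down
-- to the x-axis, and repeats.  The first argument is fuel.
bounceAux : ℕ → ℕ → List Step → List Step
bounceAux zero    c d = []
bounceAux (suc f) c d with upsBefore c d ∸ c
... | zero  = []
... | suc k = replicate (suc k) U ++ replicate (suc k) D ++ bounceAux f (c Data.Nat.+ suc k) d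

bounce : List Step → List Step
bounce d = bounceAux (length d) 0 d

-- can(d, σ) and des(d, σ).  Labels are values in {0,…,n-1} (σ_i - 1).

nth : List ℕ → ℕ → ℕ
nth []       _       = 0
nth (x ∷ xs) zero    = x
nth (x ∷ xs) (suc i) = nth xs i

perm→list : ∀ {n} → Permutation′ n → List ℕ
perm→list {n} σ = map (λ i → toℕ (σ ⟨$⟩ʳ i)) (Data.List.allFin n)

-- canAux labels u ds d : u up-steps and ds down-steps already read
canAux : List ℕ → ℕ → ℕ → List Step → List ℕ
canAux ls u ds []      = []
canAux ls u ds (U ∷ s) = nth ls u  ∷ canAux ls (suc u) ds s
canAux ls u ds (D ∷ s) = nth ls ds ∷ canAux ls u (suc ds) s

can : ∀ {n} → List Step → Permutation′ n → List ℕ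
can d σ = canAux (perm→list σ) 0 0 d

descents : List ℕ → ℕ
descents []           = 0
descents (x ∷ [])     = 0
descents (x ∷ y ∷ ws) = (if y <ᵇ x then 1 else 0) Data.Nat.+ descents (y ∷ ws)

des : ∀ {n} → List Step → Permutation′ n → ℕ
des d σ = descents (can d σ)

-- σ ∈ M_d : des(d,σ) equals m_d = max over all permutations
InM : ∀ {n} → List Step → Permutation′ n → Set
InM {n} d σ = ∀ (τ : Permutation′ n) → des d τ ≤ des d σ

-- σ is δ_n = n(n-1)⋯1  (σ_i = n+1-i, i.e. 0-indexed value n-1-i)
IsDelta : ∀ {n} → Permutation′ n → Set
IsDelta {n} σ = ∀ (i : Fin n) → σ ⟨$⟩ʳ i ≡ opposite i

MIsDelta : ℕ → List Step → Set
MIsDelta n d = ∀ (σ : Permutation′ n) → (InM d σ → IsDelta σ) × (IsDelta σ → InM d σ)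

module Submission where

-- A Dyck path equals its bounce path exactly when it is a stack of pyramids U^(a+1) D^(a+1).
--
-- For a stack of k pyramids, can(d, σ) is B₁B₁B₂B₂⋯BₖBₖ, where B₁B₂⋯Bₖ is σ cut into consecutive
-- blocks. All these words have length 2n, so maximising descents means minimising weak ascents, and
-- each square BᵢBᵢ has a weak ascent where Bᵢ restarts. Hence every σ has at least k weak ascents,
-- with equality exactly when σ is decreasing, that is σ = δₙ.
--
-- Any other Dyck path, after a stack of pyramids of semilength c, climbs p + q steps, descends p and
-- climbs again at height q > 0. The descents of can(d, δₙ) are the ascents of the word of positions
-- that can reads from σ, and if s exchanges the blocks [c, c+p) and [c+p, c+p+q), then i ↦ n-1-s(i)
-- has as many descents on d as δₙ, so δₙ is not the only maximiser.

open import Defs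
open import Data.Nat using (ℕ)
open import Data.List using (List)
open import Data.Product using (_×_)
open import Relation.Binary.PropositionalEquality using (_≡_)

open import Data.Bool using (Bool; true; false; not; if_then_else_)
open import Data.Bool.Properties using (T-≡; not-injective)
open import Data.List using ([]; _∷_; _++_; length; map; replicate; tabulate; downFrom)
open import Data.Fin using (Fin; zero; suc; toℕ; fromℕ<; opposite)
open import Data.Fin.Properties
  using (toℕ<n; toℕ-fromℕ<; toℕ-injective; opposite-prop; opposite-involutive)
open import Data.Fin.Permutation using (Permutation′; _⟨$⟩ʳ_; permutation; reverse; _∘ₚ_)
open import Data.List.Properties
  using (map-++; map-∘; map-id; map-id-local; map-cong-local; map-tabulate; tabulate-cong;
         ++-assoc; length-map; length-tabulate; length-++-≤ʳ)
open import Data.List.Relation.Unary.All as All using (All; []; _∷_)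
open import Data.List.Relation.Unary.All.Properties using (map⁺; ++⁻ʳ)
open import Data.Nat
  using (zero; suc; _+_; _*_; _∸_; _<ᵇ_; _≤_; _<_; z≤n; s≤s; z<s; s≤s⁻¹; s<s⁻¹; _<?_; _≟_)
open import Data.Nat.Properties
open import Data.Nat.Tactic.RingSolver using (solve-∀)
open import Data.Product using (_,_; proj₁; proj₂; ∃)
open import Function using (_∘_; _⇔_; mk⇔; Equivalence)
open import Relation.Binary using (tri<; tri≈; tri>)
open import Relation.Binary.PropositionalEquality
  using (refl; sym; trans; cong; cong₂; subst; subst₂; module ≡-Reasoning)
open import Relation.Nullary using (¬_; yes; no; contradiction)

<ᵇ-true : ∀ {a b} → a < b → (a <ᵇ b) ≡ true
<ᵇ-true = Equivalence.to T-≡ ∘ <⇒<ᵇ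

<ᵇ-true⁻¹ : ∀ {a b} → (a <ᵇ b) ≡ true → a < b
<ᵇ-true⁻¹ {a} {b} = <ᵇ⇒< a b ∘ Equivalence.from T-≡

<ᵇ-false : ∀ {a b} → b ≤ a → (a <ᵇ b) ≡ false
<ᵇ-false {a} {b} b≤a with a <ᵇ b in eq
... | false = refl
... | true  = contradiction (<ᵇ-true⁻¹ eq) (≤⇒≯ b≤a)

<ᵇ-≡ : ∀ {a b c d} → (a < b ⇔ c < d) → (a <ᵇ b) ≡ (c <ᵇ d)
<ᵇ-≡ {a} {b} a<b⇔c<d with a <? b
... | yes a<b = trans (<ᵇ-true a<b) (sym (<ᵇ-true (Equivalence.to a<b⇔c<d a<b)))
... | no  a≮b = trans (<ᵇ-false (≮⇒≥ a≮b))
                      (sym (<ᵇ-false (≮⇒≥ (a≮b ∘ Equivalence.from a<b⇔c<d))))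

<ᵇ-strictMono : ∀ {P : ℕ → Set} (f : ℕ → ℕ) →
                (∀ {a b} → P a → P b → a < b → f a < f b) →
                ∀ {a b} → P a → P b → (f a <ᵇ f b) ≡ (a <ᵇ b)
<ᵇ-strictMono {P} f mono {a} {b} pa pb = <ᵇ-≡ (mk⇔ reflect (mono pa pb))
  where
  reflect : f a < f b → a < b
  reflect fa<fb with <-cmp a b
  ... | tri< a<b _ _ = a<b
  ... | tri≈ _ refl _ = contradiction fa<fb (<-irrefl refl)
  ... | tri> _ _ b<a = contradiction (mono pb pa b<a) (<-asym fa<fb)

+≡+⇒≤ : ∀ {a b c d} → a + b ≡ c + d → a ≤ c → d ≤ b
+≡+⇒≤ {a} {b} {c} {d} eq a≤c = +-cancelˡ-≤ c d b (begin
  c + d ≡⟨ eq ⟨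
  a + b ≤⟨ +-monoˡ-≤ b a≤c ⟩
  c + b ∎)
  where open ≤-Reasoning

-- Adjacent pairs in words

countAdjacent : (ℕ → ℕ → Bool) → ℕ → List ℕ → ℕ
countAdjacent r x []      = 0
countAdjacent r x (y ∷ w) = (if r x y then 1 else 0) + countAdjacent r y w

lastFrom : ℕ → List ℕ → ℕ
lastFrom x []      = x
lastFrom x (y ∷ w) = lastFrom y w

descent ascent weakAscent : ℕ → ℕ → Bool
descent    x y = y <ᵇ x
ascent     x y = x <ᵇ y
weakAscent x y = not (y <ᵇ x)

descentsFrom ascentsFrom weakAscentsFrom : ℕ → List ℕ → ℕ
descentsFrom    = countAdjacent descent
ascentsFrom     = countAdjacent ascent
weakAscentsFrom = countAdjacent weakAscent

countAdjacent-++ : ∀ r x u v →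
  countAdjacent r x (u ++ v) ≡ countAdjacent r x u + countAdjacent r (lastFrom x u) v
countAdjacent-++ r x []      v = refl
countAdjacent-++ r x (y ∷ u) v =
  trans (cong (bit +_) (countAdjacent-++ r y u v)) (sym (+-assoc bit (countAdjacent r y u) _))
  where
  bit : ℕ
  bit = if r x y then 1 else 0

countAdjacent-∷-true : ∀ r x y w → r x y ≡ true →
                       countAdjacent r x (y ∷ w) ≡ suc (countAdjacent r y w)
countAdjacent-∷-true r x y w rxy rewrite rxy = refl

countAdjacent-∷-false : ∀ r x y w → r x y ≡ false →
                        countAdjacent r x (y ∷ w) ≡ countAdjacent r y w
countAdjacent-∷-false r x y w rxy rewrite rxy = refl

countAdjacent-∷≡0 : ∀ r x y w → countAdjacent r x (y ∷ w) ≡ 0 →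
                    r x y ≡ false × countAdjacent r y w ≡ 0
countAdjacent-∷≡0 r x y w h with r x y
... | false = refl , h

countAdjacent-map : ∀ {P : ℕ → Set} {r r′ : ℕ → ℕ → Bool} (f : ℕ → ℕ) →
                    (∀ {a b} → P a → P b → r (f a) (f b) ≡ r′ a b) →
                    ∀ {x w} → P x → All P w → countAdjacent r (f x) (map f w) ≡ countAdjacent r′ x w
countAdjacent-map f r≡r′ px []         = refl
countAdjacent-map f r≡r′ px (py ∷ pw) =
  cong₂ (λ b m → (if b then 1 else 0) + m) (r≡r′ px py) (countAdjacent-map f r≡r′ py pw)

lastFrom-All : ∀ {P : ℕ → Set} {x w} → P x → All P w → P (lastFrom x w)
lastFrom-All px []        = px
lastFrom-All px (py ∷ pw) = lastFrom-All py pw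

descents-∷ : ∀ x w → descents (x ∷ w) ≡ descentsFrom x w
descents-∷ x []      = refl
descents-∷ x (y ∷ w) = cong ((if y <ᵇ x then 1 else 0) +_) (descents-∷ y w)

descentsFrom+weakAscentsFrom : ∀ x w → descentsFrom x w + weakAscentsFrom x w ≡ length w
descentsFrom+weakAscentsFrom x []      = refl
descentsFrom+weakAscentsFrom x (y ∷ w) =
  trans (complementary (y <ᵇ x)) (cong suc (descentsFrom+weakAscentsFrom y w))
  where
  complementary : ∀ b → (if b then 1 else 0) + descentsFrom y w
                          + ((if not b then 1 else 0) + weakAscentsFrom y w)
                        ≡ suc (descentsFrom y w + weakAscentsFrom y w)
  complementary true  = refl
  complementary false = +-suc _ _

descents+weakAscentsFrom : ∀ {x} w → All (_< x) w →
                           descents w + weakAscentsFrom x w ≡ length w ∸ 1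
descents+weakAscentsFrom []      []          = refl
descents+weakAscentsFrom {x} (y ∷ w) (y<x ∷ _) =
  trans (cong₂ _+_ (descents-∷ y w)
                   (countAdjacent-∷-false weakAscent x y w (cong not (<ᵇ-true y<x))))
        (descentsFrom+weakAscentsFrom y w)

weakAscentsFrom-∷≡0 : ∀ x y w → weakAscentsFrom x (y ∷ w) ≡ 0 →
                      y < x × weakAscentsFrom y w ≡ 0
weakAscentsFrom-∷≡0 x y w h =
  let y≮ᵇx , h′ = countAdjacent-∷≡0 weakAscent x y w h
  in <ᵇ-true⁻¹ (not-injective {y <ᵇ x} {true} y≮ᵇx) , h′

lastFrom-≤ : ∀ x w → weakAscentsFrom x w ≡ 0 → lastFrom x w ≤ x
lastFrom-≤ x []      _ = ≤-refl
lastFrom-≤ x (y ∷ w) h =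
  let y<x , h′ = weakAscentsFrom-∷≡0 x y w h in ≤-trans (lastFrom-≤ y w h′) (<⇒≤ y<x)

length-≤-weakAscentsFrom≡0 : ∀ x w → weakAscentsFrom x w ≡ 0 → length w ≤ x
length-≤-weakAscentsFrom≡0 x []      _ = z≤n
length-≤-weakAscentsFrom≡0 x (y ∷ w) h =
  let y<x , h′ = weakAscentsFrom-∷≡0 x y w h in ≤-<-trans (length-≤-weakAscentsFrom≡0 y w h′) y<x

weakAscentsFrom≡0⇒downFrom : ∀ x w → weakAscentsFrom x w ≡ 0 → length w ≡ x → w ≡ downFrom x
weakAscentsFrom≡0⇒downFrom x       []      _ refl = refl
weakAscentsFrom≡0⇒downFrom (suc m) (y ∷ w) h len with weakAscentsFrom-∷≡0 (suc m) y w h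
... | y<x , h′ = cong₂ _∷_ y≡m (trans w≡downFrom-y (cong downFrom y≡m))
  where
  y≡m : y ≡ m
  y≡m = ≤-antisym (s≤s⁻¹ y<x)
                  (subst (_≤ y) (suc-injective len) (length-≤-weakAscentsFrom≡0 y w h′))
  w≡downFrom-y : w ≡ downFrom y
  w≡downFrom-y = weakAscentsFrom≡0⇒downFrom y w h′ (trans (suc-injective len) (sym y≡m))

weakAscentsFrom-downFrom : ∀ n → weakAscentsFrom n (downFrom n) ≡ 0
weakAscentsFrom-downFrom zero    = refl
weakAscentsFrom-downFrom (suc n) =
  trans (countAdjacent-∷-false weakAscent (suc n) n (downFrom n) (cong not (<ᵇ-true (n<1+n n))))
        (weakAscentsFrom-downFrom n)

-- weakAscentsFrom (lastFrom y w) (y ∷ w) counts the weak ascents of y ∷ w read cyclically.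
weakAscentsFrom-cycle≡1 : ∀ y w → weakAscentsFrom y w ≡ 0 →
                          weakAscentsFrom (lastFrom y w) (y ∷ w) ≡ 1
weakAscentsFrom-cycle≡1 y w h =
  trans (countAdjacent-∷-true weakAscent (lastFrom y w) y w (cong not (<ᵇ-false (lastFrom-≤ y w h))))
        (cong suc h)

weakAscentsFrom-cycle≥1 : ∀ y w → 1 ≤ weakAscentsFrom (lastFrom y w) (y ∷ w)
weakAscentsFrom-cycle≥1 y w with weakAscentsFrom y w ≟ 0
... | yes h = ≤-reflexive (sym (weakAscentsFrom-cycle≡1 y w h))
... | no  h = ≤-trans (n≢0⇒n>0 h) (m≤n+m _ _)

descents-complement : ∀ {n} w → All (_< n) w → descents (map (λ i → n ∸ suc i) w) ≡ ascentsFrom n w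
descents-complement     []      []           = refl
descents-complement {n} (y ∷ w) (y<n ∷ w<n) = begin
  descents (map complement (y ∷ w))            ≡⟨ descents-∷ (complement y) (map complement w) ⟩
  descentsFrom (complement y) (map complement w) ≡⟨ countAdjacent-map complement complement-<ᵇ y<n w<n ⟩
  ascentsFrom y w                              ≡⟨ countAdjacent-∷-false ascent n y w (<ᵇ-false (<⇒≤ y<n)) ⟨
  ascentsFrom n (y ∷ w)                        ∎
  where
  open ≡-Reasoning
  complement : ℕ → ℕ
  complement i = n ∸ suc i
  complement-<ᵇ : ∀ {a b} → a < n → b < n → (complement b <ᵇ complement a) ≡ (a <ᵇ b)
  complement-<ᵇ a<n b<n =
    <ᵇ-≡ (mk⇔ (s<s⁻¹ ∘ ∸-cancelʳ-< {o = n}) (λ a<b → ∸-monoʳ-< (s≤s a<b) b<n))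

interval : ℕ → ℕ → List ℕ
interval c zero    = []
interval c (suc m) = c ∷ interval (suc c) m

interval-++ : ∀ c m k → interval c (m + k) ≡ interval c m ++ interval (c + m) k
interval-++ c zero    k = cong (λ x → interval x k) (sym (+-identityʳ c))
interval-++ c (suc m) k =
  cong (c ∷_) (trans (interval-++ (suc c) m k)
                     (cong (λ x → interval (suc c) m ++ interval x k) (sym (+-suc c m))))

map-interval : ∀ (f : ℕ → ℕ) c e m → (∀ k → k < m → f (c + k) ≡ e + k) →
               map f (interval c m) ≡ interval e m
map-interval f c e zero    _     = refl
map-interval f c e (suc m) f-inc = cong₂ _∷_ fc≡e (map-interval f (suc c) (suc e) m f-inc′)
  where
  fc≡e : f c ≡ e
  fc≡e = trans (cong f (sym (+-identityʳ c))) (trans (f-inc 0 z<s) (+-identityʳ e))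
  f-inc′ : ∀ k → k < m → f (suc c + k) ≡ suc e + k
  f-inc′ k k<m = trans (cong f (sym (+-suc c k))) (trans (f-inc (suc k) (s≤s k<m)) (+-suc e k))

map-nth-interval : ∀ ℓ → map (nth ℓ) (interval 0 (length ℓ)) ≡ ℓ
map-nth-interval []      = refl
map-nth-interval (x ∷ ℓ) = cong (x ∷_) (trans (shift 0 (length ℓ)) (map-nth-interval ℓ))
  where
  shift : ∀ c m → map (nth (x ∷ ℓ)) (interval (suc c) m) ≡ map (nth ℓ) (interval c m)
  shift c zero    = refl
  shift c (suc m) = cong (nth ℓ c ∷_) (shift (suc c) m)

ascentsFrom-interval : ∀ x y m w →
  ascentsFrom x (interval y (suc m) ++ w) ≡ (if x <ᵇ y then 1 else 0) + (m + ascentsFrom (y + m) w)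
ascentsFrom-interval x y zero    w =
  cong (λ z → (if x <ᵇ y then 1 else 0) + ascentsFrom z w) (sym (+-identityʳ y))
ascentsFrom-interval x y (suc m) w = cong ((if x <ᵇ y then 1 else 0) +_) (begin
  ascentsFrom y (interval (suc y) (suc m) ++ w)
    ≡⟨ ascentsFrom-interval y (suc y) m w ⟩
  (if y <ᵇ suc y then 1 else 0) + (m + ascentsFrom (suc y + m) w)
    ≡⟨ cong₂ (λ b z → (if b then 1 else 0) + (m + ascentsFrom z w))
             (<ᵇ-true (n<1+n y)) (sym (+-suc y m)) ⟩
  suc (m + ascentsFrom (y + suc m) w) ∎)
  where open ≡-Reasoning

-- Step counts and index words

ups downs : List Step → ℕ
ups []      = 0
ups (U ∷ w) = suc (ups w)
ups (D ∷ w) = ups w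
downs []      = 0
downs (U ∷ w) = downs w
downs (D ∷ w) = suc (downs w)

ups-replicate-U : ∀ m w → ups (replicate m U ++ w) ≡ m + ups w
ups-replicate-U zero    w = refl
ups-replicate-U (suc m) w = cong suc (ups-replicate-U m w)

ups-replicate-D : ∀ m w → ups (replicate m D ++ w) ≡ ups w
ups-replicate-D zero    w = refl
ups-replicate-D (suc m) w = ups-replicate-D m w

downs-replicate-U : ∀ m w → downs (replicate m U ++ w) ≡ downs w
downs-replicate-U zero    w = refl
downs-replicate-U (suc m) w = downs-replicate-U m w

downs-replicate-D : ∀ m w → downs (replicate m D ++ w) ≡ m + downs w
downs-replicate-D zero    w = refl
downs-replicate-D (suc m) w = cong suc (downs-replicate-D m w)

ValidFrom-downs : ∀ {h w} → ValidFrom h w → downs w ≡ h + ups w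
ValidFrom-downs end                = refl
ValidFrom-downs {h} {U ∷ w} (up v) = trans (ValidFrom-downs v) (sym (+-suc h (ups w)))
ValidFrom-downs (down v)           = cong suc (ValidFrom-downs v)

length≡ups+downs : ∀ w → length w ≡ ups w + downs w
length≡ups+downs []      = refl
length≡ups+downs (U ∷ w) = cong suc (length≡ups+downs w)
length≡ups+downs (D ∷ w) = trans (cong suc (length≡ups+downs w)) (sym (+-suc (ups w) (downs w)))

IsDyck-ups : ∀ {n d} → IsDyck n d → ups d ≡ n
IsDyck-ups {n} {d} (length≡2n , valid) = *-cancelˡ-≡ (ups d) n 2 (begin
  2 * ups d         ≡⟨ cong (ups d +_) (+-identityʳ (ups d)) ⟩
  ups d + ups d     ≡⟨ cong (ups d +_) (ValidFrom-downs valid) ⟨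
  ups d + downs d   ≡⟨ length≡ups+downs d ⟨
  length d          ≡⟨ length≡2n ⟩
  2 * n             ∎)
  where open ≡-Reasoning

IsDyck-downs : ∀ {n d} → IsDyck n d → downs d ≡ n
IsDyck-downs dyck@(_ , valid) = trans (ValidFrom-downs valid) (IsDyck-ups dyck)

indexWord : ℕ → ℕ → List Step → List ℕ
indexWord u ds []      = []
indexWord u ds (U ∷ w) = u  ∷ indexWord (suc u) ds w
indexWord u ds (D ∷ w) = ds ∷ indexWord u (suc ds) w

canAux≡map-indexWord : ∀ ℓ u ds w → canAux ℓ u ds w ≡ map (nth ℓ) (indexWord u ds w)
canAux≡map-indexWord ℓ u ds []      = refl
canAux≡map-indexWord ℓ u ds (U ∷ w) = cong (nth ℓ u ∷_)  (canAux≡map-indexWord ℓ (suc u) ds w)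
canAux≡map-indexWord ℓ u ds (D ∷ w) = cong (nth ℓ ds ∷_) (canAux≡map-indexWord ℓ u (suc ds) w)

indexWord-++ : ∀ u ds v w →
  indexWord u ds (v ++ w) ≡ indexWord u ds v ++ indexWord (u + ups v) (ds + downs v) w
indexWord-++ u ds []      w =
  cong₂ (λ u′ ds′ → indexWord u′ ds′ w) (sym (+-identityʳ u)) (sym (+-identityʳ ds))
indexWord-++ u ds (U ∷ v) w = cong (u ∷_) (trans (indexWord-++ (suc u) ds v w)
  (cong (λ u′ → indexWord (suc u) ds v ++ indexWord u′ (ds + downs v) w) (sym (+-suc u (ups v)))))
indexWord-++ u ds (D ∷ v) w = cong (ds ∷_) (trans (indexWord-++ u (suc ds) v w)
  (cong (λ ds′ → indexWord u (suc ds) v ++ indexWord (u + ups v) ds′ w) (sym (+-suc ds (downs v)))))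

indexWord-replicate-U : ∀ u ds m w →
  indexWord u ds (replicate m U ++ w) ≡ interval u m ++ indexWord (u + m) ds w
indexWord-replicate-U u ds zero    w = cong (λ u′ → indexWord u′ ds w) (sym (+-identityʳ u))
indexWord-replicate-U u ds (suc m) w = cong (u ∷_) (trans (indexWord-replicate-U (suc u) ds m w)
  (cong (λ u′ → interval (suc u) m ++ indexWord u′ ds w) (sym (+-suc u m))))

indexWord-replicate-D : ∀ u ds m w →
  indexWord u ds (replicate m D ++ w) ≡ interval ds m ++ indexWord u (ds + m) w
indexWord-replicate-D u ds zero    w = cong (λ ds′ → indexWord u ds′ w) (sym (+-identityʳ ds))
indexWord-replicate-D u ds (suc m) w = cong (ds ∷_) (trans (indexWord-replicate-D u (suc ds) m w)
  (cong (λ ds′ → interval (suc ds) m ++ indexWord u ds′ w) (sym (+-suc ds m))))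

indexWord-< : ∀ {K} u ds w → u + ups w ≤ K → ds + downs w ≤ K → All (_< K) (indexWord u ds w)
indexWord-< u ds []      _   _    = []
indexWord-< {K} u ds (U ∷ w) u≤K ds≤K =
  ≤-trans (s≤s (m≤m+n u (ups w))) u≤K′ ∷ indexWord-< (suc u) ds w u≤K′ ds≤K
  where
  u≤K′ : suc u + ups w ≤ K
  u≤K′ = subst (_≤ K) (+-suc u (ups w)) u≤K
indexWord-< {K} u ds (D ∷ w) u≤K ds≤K =
  ≤-trans (s≤s (m≤m+n ds (downs w))) ds≤K′ ∷ indexWord-< u (suc ds) w u≤K ds≤K′
  where
  ds≤K′ : suc ds + downs w ≤ K
  ds≤K′ = subst (_≤ K) (+-suc ds (downs w)) ds≤K

indexWord-≥ : ∀ {L} u ds w → L ≤ u → L ≤ ds → All (L ≤_) (indexWord u ds w)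
indexWord-≥ u ds []      _    _     = []
indexWord-≥ u ds (U ∷ w) L≤u L≤ds = L≤u  ∷ indexWord-≥ (suc u) ds w (m≤n⇒m≤1+n L≤u) L≤ds
indexWord-≥ u ds (D ∷ w) L≤u L≤ds = L≤ds ∷ indexWord-≥ u (suc ds) w L≤u (m≤n⇒m≤1+n L≤ds)

indexWord-Dyck-< : ∀ {n d} → IsDyck n d → All (_< n) (indexWord 0 0 d)
indexWord-Dyck-< {d = d} dyck =
  indexWord-< 0 0 d (≤-reflexive (IsDyck-ups dyck)) (≤-reflexive (IsDyck-downs dyck))

-- Labels of a permutation

label : ∀ {n} → Permutation′ n → ℕ → ℕ
label σ = nth (perm→list σ)

nth-tabulate : ∀ {n} (g : Fin n → ℕ) i → nth (tabulate g) (toℕ i) ≡ g i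
nth-tabulate g zero    = refl
nth-tabulate g (suc i) = nth-tabulate (g ∘ suc) i

perm→list-tabulate : ∀ {n} (σ : Permutation′ n) → perm→list σ ≡ tabulate (λ i → toℕ (σ ⟨$⟩ʳ i))
perm→list-tabulate σ = map-tabulate (λ i → i) (λ i → toℕ (σ ⟨$⟩ʳ i))

length-perm→list : ∀ {n} (σ : Permutation′ n) → length (perm→list σ) ≡ n
length-perm→list σ = trans (cong length (perm→list-tabulate σ)) (length-tabulate _)

label-toℕ : ∀ {n} (σ : Permutation′ n) i → label σ (toℕ i) ≡ toℕ (σ ⟨$⟩ʳ i)
label-toℕ σ i = trans (cong (λ ℓ → nth ℓ (toℕ i)) (perm→list-tabulate σ)) (nth-tabulate _ i)

label-fromℕ< : ∀ {n i} (σ : Permutation′ n) (i<n : i < n) → label σ i ≡ toℕ (σ ⟨$⟩ʳ fromℕ< i<n)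
label-fromℕ< σ i<n = trans (cong (label σ) (sym (toℕ-fromℕ< i<n))) (label-toℕ σ (fromℕ< i<n))

label-< : ∀ {n i} (σ : Permutation′ n) → i < n → label σ i < n
label-< σ i<n = subst (_< _) (sym (label-fromℕ< σ i<n)) (toℕ<n _)

map-label-interval : ∀ {n} (σ : Permutation′ n) → map (label σ) (interval 0 n) ≡ perm→list σ
map-label-interval σ = subst (λ m → map (label σ) (interval 0 m) ≡ perm→list σ)
                              (length-perm→list σ) (map-nth-interval (perm→list σ))

tabulate-downFrom : ∀ n → tabulate (λ (i : Fin n) → n ∸ suc (toℕ i)) ≡ downFrom n
tabulate-downFrom zero    = refl
tabulate-downFrom (suc n) = cong (n ∷_) (tabulate-downFrom n)

IsDelta⇔perm→list≡downFrom : ∀ {n} (σ : Permutation′ n) → IsDelta σ ⇔ perm→list σ ≡ downFrom n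
IsDelta⇔perm→list≡downFrom {n} σ = mk⇔ to from
  where
  open ≡-Reasoning
  to : IsDelta σ → perm→list σ ≡ downFrom n
  to δ = begin
    perm→list σ                                ≡⟨ perm→list-tabulate σ ⟩
    tabulate (λ i → toℕ (σ ⟨$⟩ʳ i))            ≡⟨ tabulate-cong (λ i → trans (cong toℕ (δ i)) (opposite-prop i)) ⟩
    tabulate (λ (i : Fin n) → n ∸ suc (toℕ i)) ≡⟨ tabulate-downFrom n ⟩
    downFrom n                                 ∎
  from : perm→list σ ≡ downFrom n → IsDelta σ
  from σ≡downFrom i = toℕ-injective (begin
    toℕ (σ ⟨$⟩ʳ i)
      ≡⟨ label-toℕ σ i ⟨
    nth (perm→list σ) (toℕ i)
      ≡⟨ cong (λ ℓ → nth ℓ (toℕ i)) (trans σ≡downFrom (sym (tabulate-downFrom n))) ⟩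
    nth (tabulate (λ (j : Fin n) → n ∸ suc (toℕ j))) (toℕ i)
      ≡⟨ nth-tabulate _ i ⟩
    n ∸ suc (toℕ i)
      ≡⟨ opposite-prop i ⟨
    toℕ (opposite i) ∎)

label-IsDelta : ∀ {n i} (σ : Permutation′ n) → IsDelta σ → i < n → label σ i ≡ n ∸ suc i
label-IsDelta {n} σ δ i<n = trans (label-fromℕ< σ i<n)
  (trans (cong toℕ (δ _)) (trans (opposite-prop _) (cong (λ j → n ∸ suc j) (toℕ-fromℕ< i<n))))

label-∘ₚ-reverse : ∀ {n i} (π : Permutation′ n) → i < n →
                   label (π ∘ₚ reverse) i ≡ n ∸ suc (label π i)
label-∘ₚ-reverse {n} π i<n = trans (label-fromℕ< (π ∘ₚ reverse) i<n)
  (trans (opposite-prop _) (cong (λ j → n ∸ suc j) (sym (label-fromℕ< π i<n))))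

IsDelta-∘ₚ-reverse : ∀ {n i} (π : Permutation′ n) → IsDelta (π ∘ₚ reverse) → i < n →
                     label π i ≡ i
IsDelta-∘ₚ-reverse π δ i<n =
  trans (label-fromℕ< π i<n) (trans (cong toℕ π-fixes) (toℕ-fromℕ< i<n))
  where
  π-fixes : π ⟨$⟩ʳ fromℕ< i<n ≡ fromℕ< i<n
  π-fixes = trans (sym (opposite-involutive _)) (trans (cong opposite (δ _)) (opposite-involutive _))

des-indexWord : ∀ {n} d (σ : Permutation′ n) →
                des d σ ≡ descents (map (label σ) (indexWord 0 0 d))
des-indexWord d σ = cong descents (canAux≡map-indexWord (perm→list σ) 0 0 d)

des-complement : ∀ {n d} (σ : Permutation′ n) (g : ℕ → ℕ) → IsDyck n d →
                 (∀ {i} → i < n → g i < n) → (∀ {i} → i < n → label σ i ≡ n ∸ suc (g i)) →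
                 des d σ ≡ ascentsFrom n (map g (indexWord 0 0 d))
des-complement {n} {d} σ g dyck g<n label≡ = begin
  des d σ
    ≡⟨ des-indexWord d σ ⟩
  descents (map (label σ) W)
    ≡⟨ cong descents (trans (map-cong-local (All.map label≡ W<n)) (map-∘ W)) ⟩
  descents (map (λ i → n ∸ suc i) (map g W))
    ≡⟨ descents-complement (map g W) (map⁺ (All.map g<n W<n)) ⟩
  ascentsFrom n (map g W) ∎
  where
  open ≡-Reasoning
  W : List ℕ
  W = indexWord 0 0 d
  W<n : All (_< n) W
  W<n = indexWord-Dyck-< dyck

-- Pyramids and the bounce path

pyramids : List ℕ → List Step
pyramids []      = []
pyramids (a ∷ s) = replicate (suc a) U ++ replicate (suc a) D ++ pyramids s

semilength : List ℕ → ℕ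
semilength []      = 0
semilength (a ∷ s) = suc a + semilength s

ups-pyramids : ∀ s → ups (pyramids s) ≡ semilength s
ups-pyramids []      = refl
ups-pyramids (a ∷ s) = trans (ups-replicate-U (suc a) _)
                             (cong (suc a +_) (trans (ups-replicate-D (suc a) _) (ups-pyramids s)))

downs-pyramids : ∀ s → downs (pyramids s) ≡ semilength s
downs-pyramids []      = refl
downs-pyramids (a ∷ s) = trans (downs-replicate-U (suc a) _)
                               (trans (downs-replicate-D (suc a) _) (cong (suc a +_) (downs-pyramids s)))

length-≤-pyramids : ∀ s → length s ≤ length (pyramids s)
length-≤-pyramids []      = z≤n
length-≤-pyramids (a ∷ s) = s≤s (≤-trans (length-≤-pyramids s)
  (≤-trans (length-++-≤ʳ (pyramids s) {replicate (suc a) D})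
           (length-++-≤ʳ (replicate (suc a) D ++ pyramids s) {replicate a U})))

pyramids-∷-++ : ∀ a s w →
  pyramids (a ∷ s) ++ w ≡ replicate (suc a) U ++ replicate (suc a) D ++ (pyramids s ++ w)
pyramids-∷-++ a s w = trans (++-assoc (replicate (suc a) U) _ w)
  (cong (replicate (suc a) U ++_) (++-assoc (replicate (suc a) D) (pyramids s) w))

indexWord-pyramids-∷ : ∀ c a s → indexWord c c (pyramids (a ∷ s))
  ≡ interval c (suc a) ++ interval c (suc a) ++ indexWord (c + suc a) (c + suc a) (pyramids s)
indexWord-pyramids-∷ c a s = trans (indexWord-replicate-U c c (suc a) _)
  (cong (interval c (suc a) ++_) (indexWord-replicate-D (c + suc a) c (suc a) (pyramids s)))

upsBefore-replicate-U : ∀ k m w → upsBefore k (replicate m U ++ w) ≡ m + upsBefore k w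
upsBefore-replicate-U k zero    w = refl
upsBefore-replicate-U k (suc m) w = cong suc (upsBefore-replicate-U k m w)

upsBefore-replicate-D : ∀ k m w → upsBefore (m + k) (replicate m D ++ w) ≡ upsBefore k w
upsBefore-replicate-D k zero    w = refl
upsBefore-replicate-D k (suc m) w = upsBefore-replicate-D k m w

upsBefore-pyramids-∷ : ∀ k a s →
  upsBefore (suc a + k) (pyramids (a ∷ s)) ≡ suc a + upsBefore k (pyramids s)
upsBefore-pyramids-∷ k a s = trans (upsBefore-replicate-U (suc a + k) (suc a) _)
                                   (cong (suc a +_) (upsBefore-replicate-D k (suc a) (pyramids s)))

upsBefore-0-pyramids-∷ : ∀ a s → upsBefore 0 (pyramids (a ∷ s)) ≡ suc a
upsBefore-0-pyramids-∷ a s = trans (upsBefore-replicate-U 0 (suc a) _) (+-identityʳ (suc a))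

FollowsPyramids : ℕ → List Step → List ℕ → Set
FollowsPyramids c d s = ∀ k → upsBefore (c + k) d ≡ c + upsBefore k (pyramids s)

FollowsPyramids-peak : ∀ c d s → FollowsPyramids c d s → upsBefore c d ∸ c ≡ upsBefore 0 (pyramids s)
FollowsPyramids-peak c d s follows = begin
  upsBefore c d ∸ c                       ≡⟨ cong (λ k → upsBefore k d ∸ c) (+-identityʳ c) ⟨
  upsBefore (c + 0) d ∸ c                 ≡⟨ cong (_∸ c) (follows 0) ⟩
  c + upsBefore 0 (pyramids s) ∸ c        ≡⟨ m+n∸m≡n c _ ⟩
  upsBefore 0 (pyramids s)                ∎
  where open ≡-Reasoning

FollowsPyramids-∷ : ∀ c d a s → FollowsPyramids c d (a ∷ s) → FollowsPyramids (c + suc a) d s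
FollowsPyramids-∷ c d a s follows k = begin
  upsBefore (c + suc a + k) d                 ≡⟨ cong (λ j → upsBefore j d) (+-assoc c (suc a) k) ⟩
  upsBefore (c + (suc a + k)) d               ≡⟨ follows (suc a + k) ⟩
  c + upsBefore (suc a + k) (pyramids (a ∷ s)) ≡⟨ cong (c +_) (upsBefore-pyramids-∷ k a s) ⟩
  c + (suc a + upsBefore k (pyramids s))      ≡⟨ +-assoc c (suc a) _ ⟨
  c + suc a + upsBefore k (pyramids s)        ∎
  where open ≡-Reasoning

bounceAux-pyramids : ∀ f c d s → length s ≤ f → FollowsPyramids c d s → bounceAux f c d ≡ pyramids s
bounceAux-pyramids zero    c d []      _           _       = refl
bounceAux-pyramids (suc f) c d []      _           follows
  rewrite FollowsPyramids-peak c d [] follows = refl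
bounceAux-pyramids (suc f) c d (a ∷ s) (s≤s |s|≤f) follows
  rewrite trans (FollowsPyramids-peak c d (a ∷ s) follows) (upsBefore-0-pyramids-∷ a s) =
  cong (λ t → replicate (suc a) U ++ replicate (suc a) D ++ t)
       (bounceAux-pyramids f (c + suc a) d s |s|≤f (FollowsPyramids-∷ c d a s follows))

bounce-pyramids : ∀ s → bounce (pyramids s) ≡ pyramids s
bounce-pyramids s =
  bounceAux-pyramids (length (pyramids s)) 0 (pyramids s) s (length-≤-pyramids s) (λ _ → refl)

bounceAux-pyramidal : ∀ f c d → ∃ λ s → bounceAux f c d ≡ pyramids s
bounceAux-pyramidal zero    c d = [] , refl
bounceAux-pyramidal (suc f) c d with upsBefore c d ∸ c
... | zero  = [] , refl
... | suc k with bounceAux-pyramidal f (c + suc k) d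
...   | s , eq = k ∷ s , cong (λ t → replicate (suc k) U ++ replicate (suc k) D ++ t) eq

data Shape (d : List Step) : Set where
  pyramidal : (s : List ℕ) → d ≡ pyramids s → Shape d
  reascends : (pre : List ℕ) (p q : ℕ) (r : List Step) →
              d ≡ pyramids pre ++ replicate (suc p + suc q) U ++ replicate (suc p) D ++ U ∷ r → Shape d

Shape-∷ : ∀ a {d} → Shape d → Shape (replicate (suc a) U ++ replicate (suc a) D ++ d)
Shape-∷ a (pyramidal s refl)         = pyramidal (a ∷ s) refl
Shape-∷ a (reascends pre p q r refl) = reascends (a ∷ pre) p q r (sym (pyramids-∷-++ a pre _))

replicate-suc-++ : ∀ (x : Step) m w → replicate (suc m) x ++ w ≡ replicate m x ++ x ∷ w
replicate-suc-++ x zero    w = refl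
replicate-suc-++ x (suc m) w = cong (x ∷_) (replicate-suc-++ x m w)

mutual
  shape-climbing : ∀ a w → ValidFrom (suc a) w → Shape (replicate (suc a) U ++ w)
  shape-climbing a (U ∷ w) (up v)   =
    subst Shape (replicate-suc-++ U (suc a) w) (shape-climbing (suc a) w v)
  shape-climbing a (D ∷ w) (down v) = shape-descending 0 a w v

  shape-descending : ∀ b h w → ValidFrom h w →
                     Shape (replicate (suc (b + h)) U ++ replicate (suc b) D ++ w)
  shape-descending b zero    []      end      rewrite +-identityʳ b = pyramidal (b ∷ []) refl
  shape-descending b zero    (U ∷ w) (up v)   rewrite +-identityʳ b = Shape-∷ b (shape-climbing 0 w v)
  shape-descending b (suc h) (U ∷ w) _        = reascends [] b h w refl
  shape-descending b (suc h) (D ∷ w) (down v) =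
    subst Shape (cong₂ (λ m t → replicate (suc m) U ++ t) (sym (+-suc b h))
                       (cong (D ∷_) (replicate-suc-++ D b w)))
          (shape-descending (suc b) h w v)

shape : ∀ {d} → ValidFrom 0 d → Shape d
shape end    = pyramidal [] refl
shape (up v) = shape-climbing 0 _ v

-- Stacks of pyramids

module PyramidBlock (F : ℕ → ℕ) (c a : ℕ) (s : List ℕ) where

  B′ B L W : List ℕ
  B′ = map F (interval (suc c) a)
  B  = F c ∷ B′
  L  = map F (interval (c + suc a) (semilength s))
  W  = map F (indexWord (c + suc a) (c + suc a) (pyramids s))

  t : ℕ
  t = lastFrom (F c) B′

  labels-∷ : map F (interval c (semilength (a ∷ s))) ≡ B ++ L
  labels-∷ = trans (cong (map F) (interval-++ c (suc a) (semilength s)))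
                   (map-++ F (interval c (suc a)) (interval (c + suc a) (semilength s)))

  word-∷ : map F (indexWord c c (pyramids (a ∷ s))) ≡ B ++ B ++ W
  word-∷ = trans (cong (map F) (indexWord-pyramids-∷ c a s))
                 (trans (map-++ F (interval c (suc a)) (interval c (suc a) ++ rest))
                        (cong (B ++_) (map-++ F (interval c (suc a)) rest)))
    where
    rest : List ℕ
    rest = indexWord (c + suc a) (c + suc a) (pyramids s)

-- Each doubled block B B of the labelled pyramid word has a weak ascent where B restarts.
weakAscents-pyramids-≥ : ∀ F c s x →
  length s + weakAscentsFrom x (map F (interval c (semilength s)))
  ≤ weakAscentsFrom x (map F (indexWord c c (pyramids s)))
weakAscents-pyramids-≥ F c []      x = z≤n
weakAscents-pyramids-≥ F c (a ∷ s) x = begin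
  suc (length s) + weakAscentsFrom x (map F (interval c (semilength (a ∷ s))))
    ≡⟨ cong (λ w → suc (length s) + weakAscentsFrom x w) labels-∷ ⟩
  suc (length s) + weakAscentsFrom x (B ++ L)
    ≡⟨ cong (suc (length s) +_) (countAdjacent-++ weakAscent x B L) ⟩
  suc (length s) + (weakAscentsFrom x B + weakAscentsFrom t L)
    ≡⟨ rearrange (length s) (weakAscentsFrom x B) (weakAscentsFrom t L) ⟩
  weakAscentsFrom x B + (1 + (length s + weakAscentsFrom t L))
    ≤⟨ +-monoʳ-≤ (weakAscentsFrom x B)
         (+-mono-≤ (weakAscentsFrom-cycle≥1 (F c) B′) (weakAscents-pyramids-≥ F (c + suc a) s t)) ⟩
  weakAscentsFrom x B + (weakAscentsFrom t B + weakAscentsFrom t W)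
    ≡⟨ cong (weakAscentsFrom x B +_) (countAdjacent-++ weakAscent t B W) ⟨
  weakAscentsFrom x B + weakAscentsFrom t (B ++ W)
    ≡⟨ countAdjacent-++ weakAscent x B (B ++ W) ⟨
  weakAscentsFrom x (B ++ B ++ W)
    ≡⟨ cong (weakAscentsFrom x) word-∷ ⟨
  weakAscentsFrom x (map F (indexWord c c (pyramids (a ∷ s)))) ∎
  where
  open ≤-Reasoning
  open PyramidBlock F c a s
  rearrange : ∀ l u v → suc l + (u + v) ≡ u + (1 + (l + v))
  rearrange = solve-∀

weakAscents-pyramids-≡ : ∀ F c s x →
  weakAscentsFrom x (map F (interval c (semilength s))) ≡ 0 →
  weakAscentsFrom x (map F (indexWord c c (pyramids s))) ≡ length s
weakAscents-pyramids-≡ F c []      x _          = refl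
weakAscents-pyramids-≡ F c (a ∷ s) x decreasing = begin
  weakAscentsFrom x (map F (indexWord c c (pyramids (a ∷ s))))
    ≡⟨ cong (weakAscentsFrom x) word-∷ ⟩
  weakAscentsFrom x (B ++ B ++ W)
    ≡⟨ countAdjacent-++ weakAscent x B (B ++ W) ⟩
  weakAscentsFrom x B + weakAscentsFrom t (B ++ W)
    ≡⟨ cong₂ _+_ B-decreasing (countAdjacent-++ weakAscent t B W) ⟩
  weakAscentsFrom t B + weakAscentsFrom t W
    ≡⟨ cong₂ _+_ (weakAscentsFrom-cycle≡1 (F c) B′ (proj₂ (weakAscentsFrom-∷≡0 x (F c) B′ B-decreasing)))
                 (weakAscents-pyramids-≡ F (c + suc a) s t L-decreasing) ⟩
  suc (length s) ∎
  where
  open ≡-Reasoning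
  open PyramidBlock F c a s
  BL-decreasing : weakAscentsFrom x B + weakAscentsFrom t L ≡ 0
  BL-decreasing = trans (sym (countAdjacent-++ weakAscent x B L))
                        (trans (cong (weakAscentsFrom x) (sym labels-∷)) decreasing)
  B-decreasing : weakAscentsFrom x B ≡ 0
  B-decreasing = m+n≡0⇒m≡0 _ BL-decreasing
  L-decreasing : weakAscentsFrom t L ≡ 0
  L-decreasing = m+n≡0⇒n≡0 _ BL-decreasing

module StackOfPyramids (s : List ℕ) where

  n : ℕ
  n = semilength s

  W : List ℕ
  W = indexWord 0 0 (pyramids s)

  weakAscents : Permutation′ n → ℕ
  weakAscents τ = weakAscentsFrom n (map (label τ) W)

  des+weakAscents : ∀ τ → des (pyramids s) τ + weakAscents τ ≡ length W ∸ 1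
  des+weakAscents τ = begin
    des (pyramids s) τ + weakAscents τ
      ≡⟨ cong (_+ weakAscents τ) (des-indexWord (pyramids s) τ) ⟩
    descents (map (label τ) W) + weakAscents τ
      ≡⟨ descents+weakAscentsFrom _ (map⁺ (All.map (label-< τ) W<n)) ⟩
    length (map (label τ) W) ∸ 1
      ≡⟨ cong (_∸ 1) (length-map (label τ) W) ⟩
    length W ∸ 1 ∎
    where
    open ≡-Reasoning
    W<n : All (_< n) W
    W<n = indexWord-< 0 0 (pyramids s) (≤-reflexive (ups-pyramids s)) (≤-reflexive (downs-pyramids s))

  des-≤⇔weakAscents-≥ : ∀ σ τ → des (pyramids s) τ ≤ des (pyramids s) σ ⇔ weakAscents σ ≤ weakAscents τ
  des-≤⇔weakAscents-≥ σ τ =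
    mk⇔ (+≡+⇒≤ same-length)
        (+≡+⇒≤ (trans (+-comm (weakAscents σ) _) (trans (sym same-length) (+-comm _ (weakAscents τ)))))
    where
    same-length : des (pyramids s) τ + weakAscents τ ≡ des (pyramids s) σ + weakAscents σ
    same-length = trans (des+weakAscents τ) (sym (des+weakAscents σ))

  weakAscents-≥ : ∀ τ → length s + weakAscentsFrom n (perm→list τ) ≤ weakAscents τ
  weakAscents-≥ τ = subst (λ ℓ → length s + weakAscentsFrom n ℓ ≤ weakAscents τ)
                          (map-label-interval τ) (weakAscents-pyramids-≥ (label τ) 0 s n)

  weakAscents-IsDelta : ∀ τ → IsDelta τ → weakAscents τ ≡ length s
  weakAscents-IsDelta τ δ = weakAscents-pyramids-≡ (label τ) 0 s n (begin
    weakAscentsFrom n (map (label τ) (interval 0 n)) ≡⟨ cong (weakAscentsFrom n) (map-label-interval τ) ⟩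
    weakAscentsFrom n (perm→list τ)                  ≡⟨ cong (weakAscentsFrom n) τ≡downFrom ⟩
    weakAscentsFrom n (downFrom n)                   ≡⟨ weakAscentsFrom-downFrom n ⟩
    0                                                ∎)
    where
    open ≡-Reasoning
    τ≡downFrom : perm→list τ ≡ downFrom n
    τ≡downFrom = Equivalence.to (IsDelta⇔perm→list≡downFrom τ) δ

  InM⇒IsDelta : ∀ σ → InM (pyramids s) σ → IsDelta σ
  InM⇒IsDelta σ σ∈M = Equivalence.from (IsDelta⇔perm→list≡downFrom σ)
    (weakAscentsFrom≡0⇒downFrom n (perm→list σ) σ-decreasing (length-perm→list σ))
    where
    σ-minimal : weakAscents σ ≤ length s
    σ-minimal = ≤-trans (Equivalence.to (des-≤⇔weakAscents-≥ σ reverse) (σ∈M reverse))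
                        (≤-reflexive (weakAscents-IsDelta reverse (λ _ → refl)))
    σ-decreasing : weakAscentsFrom n (perm→list σ) ≡ 0
    σ-decreasing = n≤0⇒n≡0 (+-cancelˡ-≤ (length s) _ 0
      (≤-trans (weakAscents-≥ σ) (≤-trans σ-minimal (≤-reflexive (sym (+-identityʳ (length s)))))))

  IsDelta⇒InM : ∀ σ → IsDelta σ → InM (pyramids s) σ
  IsDelta⇒InM σ δ τ = Equivalence.from (des-≤⇔weakAscents-≥ σ τ) (begin
    weakAscents σ                              ≡⟨ weakAscents-IsDelta σ δ ⟩
    length s                                   ≤⟨ m≤m+n (length s) _ ⟩
    length s + weakAscentsFrom n (perm→list τ) ≤⟨ weakAscents-≥ τ ⟩
    weakAscents τ                              ∎)
    where open ≤-Reasoning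

pyramids-MIsDelta : ∀ s → MIsDelta (semilength s) (pyramids s)
pyramids-MIsDelta s σ = InM⇒IsDelta σ , IsDelta⇒InM σ
  where open StackOfPyramids s

-- Exchanging two blocks of values

swapBlocks : ℕ → ℕ → ℕ → ℕ → ℕ
swapBlocks c p q i =
  if i <ᵇ c then i
  else if i <ᵇ c + p then i + q
  else if i <ᵇ c + (p + q) then i ∸ p
  else i

data Segment (c p q i : ℕ) : Set where
  below  : i < c → Segment c p q i
  first  : c ≤ i → i < c + p → Segment c p q i
  second : c + p ≤ i → i < c + (p + q) → Segment c p q i
  above  : c + (p + q) ≤ i → Segment c p q i

segment : ∀ c p q i → Segment c p q i
segment c p q i with i <? c | i <? c + p | i <? c + (p + q)
... | yes i<c | _         | _   = below i<c
... | no  i≮c | yes i<c+p | _   = first (≮⇒≥ i≮c) i<c+p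
... | no  _   | no  i≮c+p | yes h = second (≮⇒≥ i≮c+p) h
... | no  _   | no  _     | no  h = above (≮⇒≥ h)

module _ (c p q : ℕ) {i : ℕ} where

  swapBlocks-below : i < c → swapBlocks c p q i ≡ i
  swapBlocks-below i<c rewrite <ᵇ-true i<c = refl

  swapBlocks-first : c ≤ i → i < c + p → swapBlocks c p q i ≡ i + q
  swapBlocks-first c≤i i<c+p rewrite <ᵇ-false c≤i | <ᵇ-true i<c+p = refl

  swapBlocks-second : c + p ≤ i → i < c + (p + q) → swapBlocks c p q i ≡ i ∸ p
  swapBlocks-second c+p≤i i<top
    rewrite <ᵇ-false (≤-trans (m≤m+n c p) c+p≤i) | <ᵇ-false c+p≤i | <ᵇ-true i<top = refl

  swapBlocks-above : c + (p + q) ≤ i → swapBlocks c p q i ≡ i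
  swapBlocks-above top≤i
    rewrite <ᵇ-false (≤-trans (m≤m+n c (p + q)) top≤i)
          | <ᵇ-false (≤-trans (+-monoʳ-≤ c (m≤m+n p q)) top≤i)
          | <ᵇ-false top≤i = refl

c+[p+q]∸p : ∀ c p q → c + (p + q) ∸ p ≡ c + q
c+[p+q]∸p c p q = trans (cong (_∸ p) (rearrange c p q)) (m+n∸n≡m (c + q) p)
  where
  rearrange : ∀ c p q → c + (p + q) ≡ c + q + p
  rearrange = solve-∀

swapBlocks-inverse : ∀ c p q i → swapBlocks c q p (swapBlocks c p q i) ≡ i
swapBlocks-inverse c p q i with segment c p q i
... | below i<c =
  trans (cong (swapBlocks c q p) (swapBlocks-below c p q i<c)) (swapBlocks-below c q p i<c)
... | first c≤i i<c+p =
  trans (cong (swapBlocks c q p) (swapBlocks-first c p q c≤i i<c+p))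
        (trans (swapBlocks-second c q p (+-monoˡ-≤ q c≤i) i+q<top) (m+n∸n≡m i q))
  where
  i+q<top : i + q < c + (q + p)
  i+q<top = ≤-trans (+-monoˡ-< q i<c+p)
                    (≤-reflexive (trans (+-assoc c p q) (cong (c +_) (+-comm p q))))
... | second c+p≤i i<top =
  trans (cong (swapBlocks c q p) (swapBlocks-second c p q c+p≤i i<top))
        (trans (swapBlocks-first c q p (m+n≤o⇒m≤o∸n c c+p≤i) i∸p<c+q)
               (m∸n+n≡m (≤-trans (m≤n+m p c) c+p≤i)))
  where
  i∸p<c+q : i ∸ p < c + q
  i∸p<c+q = subst (i ∸ p <_) (c+[p+q]∸p c p q) (∸-monoˡ-< i<top (≤-trans (m≤n+m p c) c+p≤i))
... | above top≤i =
  trans (cong (swapBlocks c q p) (swapBlocks-above c p q top≤i))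
        (swapBlocks-above c q p (subst (λ m → c + m ≤ i) (+-comm p q) top≤i))

swapBlocks-< : ∀ {N} c p q {i} → c + (p + q) ≤ N → i < N → swapBlocks c p q i < N
swapBlocks-< {N} c p q {i} top≤N i<N with segment c p q i
... | below i<c = subst (_< N) (sym (swapBlocks-below c p q i<c)) i<N
... | first c≤i i<c+p = subst (_< N) (sym (swapBlocks-first c p q c≤i i<c+p))
  (≤-trans (+-monoˡ-< q i<c+p) (≤-trans (≤-reflexive (+-assoc c p q)) top≤N))
... | second c+p≤i i<top =
  subst (_< N) (sym (swapBlocks-second c p q c+p≤i i<top)) (≤-<-trans (m∸n≤m i p) i<N)
... | above top≤i = subst (_< N) (sym (swapBlocks-above c p q top≤i)) i<N

swapBlocks-strictMono : ∀ c p q {a b} → c + p ≤ a → a < b →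
                        swapBlocks c p q a < swapBlocks c p q b
swapBlocks-strictMono c p q {a} {b} c+p≤a a<b with segment c p q a | segment c p q b
... | below a<c     | _ = contradiction (≤-trans (m≤m+n c p) c+p≤a) (<⇒≱ a<c)
... | first _ a<c+p | _ = contradiction c+p≤a (<⇒≱ a<c+p)
... | _ | below b<c     = contradiction (≤-trans (m≤m+n c p) (≤-trans c+p≤a (<⇒≤ a<b))) (<⇒≱ b<c)
... | _ | first _ b<c+p = contradiction (≤-trans c+p≤a (<⇒≤ a<b)) (<⇒≱ b<c+p)
... | second c+p≤a′ a<top | second c+p≤b b<top =
  subst₂ _<_ (sym (swapBlocks-second c p q c+p≤a′ a<top))
             (sym (swapBlocks-second c p q c+p≤b b<top))
             (∸-monoˡ-< a<b (≤-trans (m≤n+m p c) c+p≤a′))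
... | second c+p≤a′ a<top | above top≤b =
  subst₂ _<_ (sym (swapBlocks-second c p q c+p≤a′ a<top)) (sym (swapBlocks-above c p q top≤b))
             (≤-<-trans (m∸n≤m a p) a<b)
... | above top≤a | second _ b<top = contradiction (≤-trans top≤a (<⇒≤ a<b)) (<⇒≱ b<top)
... | above top≤a | above top≤b =
  subst₂ _<_ (sym (swapBlocks-above c p q top≤a)) (sym (swapBlocks-above c p q top≤b)) a<b

map-swapBlocks-first : ∀ c p q → map (swapBlocks c p q) (interval c p) ≡ interval (c + q) p
map-swapBlocks-first c p q = map-interval _ c (c + q) p λ k k<p →
  trans (swapBlocks-first c p q (m≤m+n c k) (+-monoʳ-< c k<p)) (shuffle c k q)
  where
  shuffle : ∀ c k q → c + k + q ≡ c + q + k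
  shuffle = solve-∀

map-swapBlocks-second : ∀ c p q → map (swapBlocks c p q) (interval (c + p) q) ≡ interval c q
map-swapBlocks-second c p q = map-interval _ (c + p) c q λ k k<q →
  trans (swapBlocks-second c p q (m≤m+n (c + p) k)
                           (≤-trans (+-monoʳ-< (c + p) k<q) (≤-reflexive (+-assoc c p q))))
        (trans (cong (_∸ p) (shuffle c p k)) (m+n∸n≡m (c + k) p))
  where
  shuffle : ∀ c p k → c + p + k ≡ c + k + p
  shuffle = solve-∀

swapBlocksPerm : ∀ {N} c p q → c + (p + q) ≤ N → Permutation′ N
swapBlocksPerm {N} c p q top≤N = permutation (onFin p q top≤N) (onFin q p top≤N′)
                                             (inverse q p top≤N′ top≤N) (inverse p q top≤N top≤N′)
  where
  top≤N′ : c + (q + p) ≤ N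
  top≤N′ = subst (λ m → c + m ≤ N) (+-comm p q) top≤N
  onFin : ∀ p q → c + (p + q) ≤ N → Fin N → Fin N
  onFin p q le i = fromℕ< (swapBlocks-< c p q le (toℕ<n i))
  inverse : ∀ p q (le : c + (p + q) ≤ N) (le′ : c + (q + p) ≤ N) i →
            onFin q p le′ (onFin p q le i) ≡ i
  inverse p q le le′ i = toℕ-injective (trans (toℕ-fromℕ< _)
    (trans (cong (swapBlocks c q p) (toℕ-fromℕ< _)) (swapBlocks-inverse c p q (toℕ i))))

label-swapBlocksPerm : ∀ {N} c p q (top≤N : c + (p + q) ≤ N) {i} → i < N →
                       label (swapBlocksPerm c p q top≤N) i ≡ swapBlocks c p q i
label-swapBlocksPerm c p q top≤N i<N =
  trans (label-fromℕ< (swapBlocksPerm c p q top≤N) i<N)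
        (trans (toℕ-fromℕ< _) (cong (swapBlocks c p q) (toℕ-fromℕ< i<N)))

reascentWord : ℕ → ℕ → ℕ → List ℕ → List ℕ
reascentWord c p q C = interval c p ++ interval (c + p) q ++ interval c p ++ c + (p + q) ∷ C

module _ (c p q : ℕ) where

  private
    P Q z : ℕ
    P = suc p
    Q = suc q
    z = c + (P + Q)

    f : ℕ → ℕ
    f = swapBlocks c P Q

    last<top : ∀ c p q → suc (c + suc q + p) ≡ c + (suc p + suc q)
    last<top = solve-∀

  ascentsFrom-reascentWord : ∀ x C →
    ascentsFrom x (reascentWord c P Q C)
    ≡ (if x <ᵇ c then 1 else 0) + (p + suc (q + (p + suc (ascentsFrom z C))))
  ascentsFrom-reascentWord x C
    rewrite ascentsFrom-interval x c p (interval (c + P) Q ++ interval c P ++ z ∷ C)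
          | ascentsFrom-interval (c + p) (c + P) q (interval c P ++ z ∷ C)
          | ascentsFrom-interval (c + P + q) c p (z ∷ C)
          | <ᵇ-true {c + p} {c + P} (+-monoʳ-< c (n<1+n p))
          | <ᵇ-false {c + P + q} {c} (≤-trans (m≤m+n c P) (m≤m+n (c + P) q))
          | <ᵇ-true {c + p} {z} (+-monoʳ-< c (s≤s (m≤m+n p Q)))
          = refl

  ascentsFrom-swappedWord : ∀ x C →
    ascentsFrom x (interval (c + Q) P ++ interval c Q ++ interval (c + Q) P ++ z ∷ C)
    ≡ (if x <ᵇ c + Q then 1 else 0) + (p + (q + suc (p + suc (ascentsFrom z C))))
  ascentsFrom-swappedWord x C
    rewrite ascentsFrom-interval x (c + Q) p (interval c Q ++ interval (c + Q) P ++ z ∷ C)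
          | ascentsFrom-interval (c + Q + p) c q (interval (c + Q) P ++ z ∷ C)
          | ascentsFrom-interval (c + q) (c + Q) p (z ∷ C)
          | <ᵇ-false {c + Q + p} {c} (≤-trans (m≤m+n c Q) (m≤m+n (c + Q) p))
          | <ᵇ-true {c + q} {c + Q} (+-monoʳ-< c (n<1+n q))
          | <ᵇ-true {c + Q + p} {z} (≤-reflexive (last<top c p q))
          = refl

  map-swapBlocks-reascentWord : ∀ C → map f (reascentWord c P Q C)
                                ≡ interval (c + Q) P ++ interval c Q ++ interval (c + Q) P ++ z ∷ map f C
  map-swapBlocks-reascentWord C =
    trans (map-++ f (interval c P) _) (cong₂ _++_ (map-swapBlocks-first c P Q)
    (trans (map-++ f (interval (c + P) Q) _) (cong₂ _++_ (map-swapBlocks-second c P Q)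
    (trans (map-++ f (interval c P) _) (cong₂ _++_ (map-swapBlocks-first c P Q)
    (cong (_∷ map f C) (swapBlocks-above c P Q ≤-refl)))))))

  ascentsFrom-swapBlocks-above : ∀ C → All (c + P ≤_) C → ascentsFrom z (map f C) ≡ ascentsFrom z C
  ascentsFrom-swapBlocks-above C C-high =
    subst (λ y → ascentsFrom y (map f C) ≡ ascentsFrom z C) (swapBlocks-above c P Q ≤-refl)
    (countAdjacent-map f (<ᵇ-strictMono f (λ a-high _ → swapBlocks-strictMono c P Q a-high))
                       (+-monoʳ-≤ c (m≤m+n P Q)) C-high)

  -- The exchange trades the ascent c+p-1 → c+p inside the first run for the ascent c+q-1 → c+q,
  -- while every other comparison keeps its outcome.
  ascentsFrom-swapBlocks : ∀ x C → (x <ᵇ c) ≡ (x <ᵇ c + Q) → All (c + P ≤_) C →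
    ascentsFrom x (map f (reascentWord c P Q C)) ≡ ascentsFrom x (reascentWord c P Q C)
  ascentsFrom-swapBlocks x C x-outside C-high = begin
    ascentsFrom x (map f (reascentWord c P Q C))
      ≡⟨ cong (ascentsFrom x) (map-swapBlocks-reascentWord C) ⟩
    ascentsFrom x (interval (c + Q) P ++ interval c Q ++ interval (c + Q) P ++ z ∷ map f C)
      ≡⟨ ascentsFrom-swappedWord x (map f C) ⟩
    (if x <ᵇ c + Q then 1 else 0) + (p + (q + suc (p + suc (ascentsFrom z (map f C)))))
      ≡⟨ cong₂ (λ b m → (if b then 1 else 0) + (p + m)) (sym x-outside)
               (trans (+-suc q _)
                      (cong (λ m → suc (q + (p + suc m))) (ascentsFrom-swapBlocks-above C C-high))) ⟩
    (if x <ᵇ c then 1 else 0) + (p + suc (q + (p + suc (ascentsFrom z C))))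
      ≡⟨ ascentsFrom-reascentWord x C ⟨
    ascentsFrom x (reascentWord c P Q C) ∎
    where open ≡-Reasoning

  ascentsFrom-swapBlocks-prefixed : ∀ {n} A C → All (_< c) A → All (c + P ≤_) C → z < n →
    ascentsFrom n (map f (A ++ reascentWord c P Q C)) ≡ ascentsFrom n (A ++ reascentWord c P Q C)
  ascentsFrom-swapBlocks-prefixed {n} A C A-low C-high z<n = begin
    ascentsFrom n (map f (A ++ V))
      ≡⟨ cong (ascentsFrom n) (trans (map-++ f A V) (cong (_++ map f V) A-fixed)) ⟩
    ascentsFrom n (A ++ map f V)
      ≡⟨ countAdjacent-++ ascent n A (map f V) ⟩
    ascentsFrom n A + ascentsFrom ℓ (map f V)
      ≡⟨ cong (ascentsFrom n A +_) (ascentsFrom-swapBlocks ℓ C ℓ-outside C-high) ⟩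
    ascentsFrom n A + ascentsFrom ℓ V
      ≡⟨ countAdjacent-++ ascent n A V ⟨
    ascentsFrom n (A ++ V) ∎
    where
    open ≡-Reasoning
    V : List ℕ
    V = reascentWord c P Q C
    ℓ : ℕ
    ℓ = lastFrom n A
    A-fixed : map f A ≡ A
    A-fixed = map-id-local (All.map (swapBlocks-below c P Q) A-low)
    Outside : ℕ → Set
    Outside i = (i <ᵇ c) ≡ (i <ᵇ c + Q)
    ℓ-outside : Outside ℓ
    ℓ-outside = lastFrom-All {Outside}
      (trans (<ᵇ-false (≤-trans (m≤m+n c (P + Q)) (<⇒≤ z<n)))
             (sym (<ᵇ-false (≤-trans (+-monoʳ-≤ c (m≤n+m Q P)) (<⇒≤ z<n)))))
      (All.map (λ i<c → trans (<ᵇ-true i<c) (sym (<ᵇ-true (≤-trans i<c (m≤m+n c Q))))) A-low)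

-- Paths that climb again before returning to the axis

indexWord-reascending : ∀ pre p q r →
  let c = semilength pre in
  indexWord 0 0 (pyramids pre ++ replicate (p + q) U ++ replicate p D ++ U ∷ r)
  ≡ indexWord 0 0 (pyramids pre) ++ reascentWord c p q (indexWord (suc (c + (p + q))) (c + p) r)
indexWord-reascending pre p q r = begin
  indexWord 0 0 (pyramids pre ++ rest)
    ≡⟨ indexWord-++ 0 0 (pyramids pre) rest ⟩
  A ++ indexWord (ups (pyramids pre)) (downs (pyramids pre)) rest
    ≡⟨ cong₂ (λ u ds → A ++ indexWord u ds rest) (ups-pyramids pre) (downs-pyramids pre) ⟩
  A ++ indexWord c c rest
    ≡⟨ cong (A ++_) (indexWord-replicate-U c c (p + q) _) ⟩
  A ++ interval c (p + q) ++ indexWord (c + (p + q)) c (replicate p D ++ U ∷ r)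
    ≡⟨ cong (A ++_) (cong₂ _++_ (interval-++ c p q)
                                (indexWord-replicate-D (c + (p + q)) c p (U ∷ r))) ⟩
  A ++ (interval c p ++ interval (c + p) q) ++ interval c p
    ++ indexWord (c + (p + q)) (c + p) (U ∷ r)
    ≡⟨ cong (A ++_) (++-assoc (interval c p) _ _) ⟩
  A ++ reascentWord c p q (indexWord (suc (c + (p + q))) (c + p) r) ∎
  where
  open ≡-Reasoning
  c : ℕ
  c = semilength pre
  A : List ℕ
  A = indexWord 0 0 (pyramids pre)
  rest : List Step
  rest = replicate (p + q) U ++ replicate p D ++ U ∷ r

module Reascending {n : ℕ} (pre : List ℕ) (p q : ℕ) (r : List Step)
  (dyck : IsDyck n (pyramids pre ++ replicate (suc p + suc q) U ++ replicate (suc p) D ++ U ∷ r)) where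

  d : List Step
  d = pyramids pre ++ replicate (suc p + suc q) U ++ replicate (suc p) D ++ U ∷ r

  c P Q z : ℕ
  c = semilength pre
  P = suc p
  Q = suc q
  z = c + (P + Q)

  A C : List ℕ
  A = indexWord 0 0 (pyramids pre)
  C = indexWord (suc z) (c + P) r

  z<n : z < n
  z<n = All.head (++⁻ʳ (interval c P) (++⁻ʳ (interval (c + P) Q) (++⁻ʳ (interval c P) (++⁻ʳ A
          (subst (All (_< n)) (indexWord-reascending pre P Q r) (indexWord-Dyck-< dyck))))))

  π : Permutation′ n
  π = swapBlocksPerm c P Q (<⇒≤ z<n)

  des-swapped : des d (π ∘ₚ reverse) ≡ des d reverse
  des-swapped = begin
    des d (π ∘ₚ reverse)
      ≡⟨ des-complement (π ∘ₚ reverse) (swapBlocks c P Q) dyck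
                        (swapBlocks-< c P Q (<⇒≤ z<n)) label-swapped ⟩
    ascentsFrom n (map (swapBlocks c P Q) (indexWord 0 0 d))
      ≡⟨ cong (ascentsFrom n ∘ map (swapBlocks c P Q)) (indexWord-reascending pre P Q r) ⟩
    ascentsFrom n (map (swapBlocks c P Q) (A ++ reascentWord c P Q C))
      ≡⟨ ascentsFrom-swapBlocks-prefixed c p q A C A-low C-high z<n ⟩
    ascentsFrom n (A ++ reascentWord c P Q C)
      ≡⟨ cong (ascentsFrom n) (trans (sym (indexWord-reascending pre P Q r)) (sym (map-id _))) ⟩
    ascentsFrom n (map (λ i → i) (indexWord 0 0 d))
      ≡⟨ des-complement reverse (λ i → i) dyck (λ i<n → i<n) (label-IsDelta reverse (λ _ → refl)) ⟨
    des d reverse ∎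
    where
    open ≡-Reasoning
    label-swapped : ∀ {i} → i < n → label (π ∘ₚ reverse) i ≡ n ∸ suc (swapBlocks c P Q i)
    label-swapped i<n = trans (label-∘ₚ-reverse π i<n)
                              (cong (λ j → n ∸ suc j) (label-swapBlocksPerm c P Q (<⇒≤ z<n) i<n))
    A-low : All (_< c) A
    A-low = indexWord-< 0 0 (pyramids pre) (≤-reflexive (ups-pyramids pre)) (≤-reflexive (downs-pyramids pre))
    C-high : All (c + P ≤_) C
    C-high = indexWord-≥ (suc z) (c + P) r (≤-trans (+-monoʳ-≤ c (m≤m+n P Q)) (n≤1+n z)) ≤-refl

  ¬MIsDelta : ¬ MIsDelta n d
  ¬MIsDelta M≡δ = m+1+n≢m c (begin
    c + Q               ≡⟨ swapBlocks-first c P Q ≤-refl (m<m+n c z<s) ⟨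
    swapBlocks c P Q c  ≡⟨ label-swapBlocksPerm c P Q (<⇒≤ z<n) c<n ⟨
    label π c           ≡⟨ IsDelta-∘ₚ-reverse π (proj₁ (M≡δ (π ∘ₚ reverse)) swapped∈M) c<n ⟩
    c                   ∎)
    where
    open ≡-Reasoning
    c<n : c < n
    c<n = ≤-<-trans (m≤m+n c (P + Q)) z<n
    swapped∈M : InM d (π ∘ₚ reverse)
    swapped∈M τ = ≤-trans (proj₂ (M≡δ reverse) (λ _ → refl) τ) (≤-reflexive (sym des-swapped))

MIsDelta⇒bounce≡ : ∀ {n d} → IsDyck n d → MIsDelta n d → bounce d ≡ d
MIsDelta⇒bounce≡ dyck M≡δ with shape (proj₂ dyck)
... | pyramidal s refl        = bounce-pyramids s
... | reascends pre p q r refl = contradiction M≡δ (Reascending.¬MIsDelta pre p q r dyck)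

bounce≡⇒MIsDelta : ∀ {n d} → IsDyck n d → bounce d ≡ d → MIsDelta n d
bounce≡⇒MIsDelta {n} {d} dyck bounce≡d with bounceAux-pyramidal (length d) 0 d
... | s , bounce≡pyramids = subst₂ MIsDelta semilength≡n pyramids≡d (pyramids-MIsDelta s)
  where
  pyramids≡d : pyramids s ≡ d
  pyramids≡d = trans (sym bounce≡pyramids) bounce≡d
  semilength≡n : semilength s ≡ n
  semilength≡n = trans (sym (ups-pyramids s)) (trans (cong ups pyramids≡d) (IsDyck-ups dyck))

corollary4p6 : (n : ℕ) (d : List Step) → IsDyck n d →
                 (MIsDelta n d → bounce d ≡ d) × (bounce d ≡ d → MIsDelta n d)
corollary4p6 n d dyck = MIsDelta⇒bounce≡ dyck , bounce≡⇒MIsDelta dyck
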